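{- Let $k\ge 2$ and let $A=\{a_1,\dots,a_k\}$ be positive integers with $\gcd(a_1,\dots,a_k)=1$. For $1\le i\le a_1-1$ let $m_i$ be the least positive integer with $m_i\equiv i\pmod{a_1}$ and $m_i\in{\rm R}(A)$, and set $m_0=0$. If $\lambda$ is a complex number with $\lambda\ne 0$ and $\lambda^{a_1}\ne 1$, then $$ \sum_{n\in{\rm NR}(A)}\lambda^n n=\frac{1}{\lambda^{a_1}-1}\sum_{i=0}^{a_1-1}m_i\lambda^{m_i}-\frac{a_1\lambda^{a_1}}{(\lambda^{a_1}-1)^2}\sum_{i=0}^{a_1-1}\lambda^{m_i}+\frac{\lambda}{(\lambda-1)^2}. $$
   Context: ${\rm R}(A)$ denotes the set of positive integers that can be written as $x_1a_1+\dots+x_ka_k$ with nonnegative integers $x_i$, and ${\rm NR}(A)$ denotes the (finite) set of positive integers not in ${\rm R}(A)$. -}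

module Defs where

open import Level using (Level; _⊔_) renaming (suc to lsuc)
open import Data.Nat using (ℕ; _≤_; _<_; s≤s)
import Data.Nat as N
open import Data.Nat.GCD using (gcd)
open import Data.Fin using (Fin; toℕ)
open import Data.Vec using (Vec; _∷_; toList; zipWith)
open import Data.List using (List; foldr; tabulate)
open import Data.Nat.ListAction using () renaming (sum to sumℕ)
open import Data.Product using (∃; _×_)
open import Data.Sum using (_⊎_)
open import Relation.Binary.PropositionalEquality using (_≡_)
open import Relation.Nullary using (¬_)
open import Algebra.Bundles using (CommutativeRing; Semiring)
import Algebra.Definitions.RawSemiring as RawSemiringDefs

-- Fields: a commutative ring with 0 ≠ 1 and a total inverse map which
-- is a genuine inverse on nonzero elements (the value at 0 is irrelevant).
-- (agda-stdlib 2.3 has no Field bundle.)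

record Field (c ℓ : Level) : Set (lsuc (c ⊔ ℓ)) where
  field
    commutativeRing : CommutativeRing c ℓ
  open CommutativeRing commutativeRing public
  field
    _⁻¹      : Carrier → Carrier
    0≉1      : ¬ (0# ≈ 1#)
    ⁻¹-inverseʳ : ∀ x → ¬ (x ≈ 0#) → x * (x ⁻¹) ≈ 1#
  open RawSemiringDefs (Semiring.rawSemiring semiring) public using (_^_) renaming (_×_ to _·_)

  infixl 7 _/_
  _/_ : Carrier → Carrier → Carrier
  x / y = x * (y ⁻¹)

  ∑ : List Carrier → Carrier
  ∑ = foldr _+_ 0#

a₁-of : ∀ {k} → 2 ≤ k → Vec ℕ k → ℕ
a₁-of (s≤s _) (a ∷ _) = a

gcdVec : ∀ {k} → Vec ℕ k → ℕ
gcdVec A = foldr gcd 0 (toList A)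

R : ∀ {k} → Vec ℕ k → ℕ → Set
R {k} A n = (0 < n) × ∃ λ (x : Vec ℕ k) → sumℕ (toList (zipWith N._*_ x A)) ≡ n

NR : ∀ {k} → Vec ℕ k → ℕ → Set
NR A n = (0 < n) × ¬ R A n

infix 4 _≡_[mod_]
_≡_[mod_] : ℕ → ℕ → ℕ → Set
a ≡ b [mod m ] = (∃ λ q → a N.+ q N.* m ≡ b) ⊎ (∃ λ q → a ≡ b N.+ q N.* m)

-- Write a = a₁, q = λᵃ and rᵢ = toℕ i. Since mᵢ is the least element of R(A) in its class
-- mod a and R(A) is closed under adding a, the gaps in the class of rᵢ are exactly the
-- progression rᵢ, rᵢ + a, …, mᵢ − a. Over such a progression both power sums telescope:
--   (q − 1) Σ λⁿ = λ^mᵢ − λ^rᵢ   and   (q − 1) Σ n λⁿ = mᵢ λ^mᵢ − rᵢ λ^rᵢ − a q Σ λⁿ.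
-- Summing over the residues, and evaluating Σ_{r<a} λʳ and Σ_{r<a} r λʳ by the same
-- telescoping with step 1, gives a triangular linear system whose solution is the formula.
module Submission where

open import Defs
open import Level using (Level)
open import Data.Nat using (ℕ; _≤_; _<_)
open import Data.Fin using (Fin; toℕ)
open import Data.Vec using (Vec)
open import Data.Vec.Relation.Unary.All using (All)
open import Data.List using (List; map; tabulate)
open import Data.List.Relation.Unary.Unique.Propositional using (Unique)
open import Data.List.Membership.Propositional using (_∈_)
open import Data.Product using (_×_)
open import Function.Bundles using (_⇔_)
open import Relation.Binary.PropositionalEquality using (_≡_)
open import Relation.Nullary using (¬_)

open import Algebra.Bundles using (CommutativeRing)
import Algebra.Properties.Monoid.Mult
import Algebra.Properties.Semiring.Sum
import Data.Nat as ℕ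
open import Data.Nat using (zero; suc; z≤n; s≤s)
open import Data.Nat.Tactic.RingSolver using (solve-∀)
open import Data.List using (applyUpTo)
open import Data.Vec using (_∷_)
open import Data.Vec.Relation.Unary.All using (_∷_)
import Function.Properties.Equivalence as ⇔
import Relation.Binary.PropositionalEquality as ≡

module IntegerCoefficients {c ℓ} (CR : CommutativeRing c ℓ) where

  import Data.Nat.Properties as ℕ
  open import Data.Integer.Base as ℤ using (ℤ; +_; -[1+_]; _⊖_; _◃_; sign; ∣_∣)
  import Data.Integer.Properties as ℤ
  open import Data.Sign.Base as Sign using (Sign)
  open import Data.Maybe.Base using (Maybe; just; nothing)
  open import Relation.Nullary.Decidable.Core using (yes; no)
  open import Algebra.Solver.Ring.AlmostCommutativeRing
    using (fromCommutativeRing; _-Raw-AlmostCommutative⟶_)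
  open CommutativeRing CR
  -- The optimised multiple makes fromℤ (+ 1) reduce to 1#, so that solver
  -- equations written with con (+ 1) match goals written with 1#.
  open import Algebra.Properties.Semiring.Mult.TCOptimised semiring
    using (1+×; ×-homo-+; ×-cong; ×1-homo-*) renaming (_×_ to _×′_)
  open import Algebra.Properties.Ring ring
    using (-0#≈0#; -‿involutive; -‿+-comm; -‿distribˡ-*; -‿distribʳ-*)
  open import Relation.Binary.Reasoning.Setoid setoid

  private

    fromℤ : ℤ → Carrier
    fromℤ (+ n)    = n ×′ 1#
    fromℤ -[1+ n ] = - (suc n ×′ 1#)

    signed : Sign → Carrier → Carrier
    signed Sign.+ x = x
    signed Sign.- x = - x

    signed-cong : ∀ s {x y} → x ≈ y → signed s x ≈ signed s y
    signed-cong Sign.+ x≈y = x≈y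
    signed-cong Sign.- x≈y = -‿cong x≈y

    signed-* : ∀ s t x y → signed (s Sign.* t) (x * y) ≈ signed s x * signed t y
    signed-* Sign.+ Sign.+ x y = refl
    signed-* Sign.+ Sign.- x y = -‿distribʳ-* x y
    signed-* Sign.- Sign.+ x y = -‿distribˡ-* x y
    signed-* Sign.- Sign.- x y = begin
      x * y         ≈⟨ -‿involutive (x * y) ⟨
      - - (x * y)   ≈⟨ -‿cong (-‿distribˡ-* x y) ⟩
      - (- x * y)   ≈⟨ -‿distribʳ-* (- x) y ⟩
      - x * - y     ∎

    fromℤ-◃ : ∀ s n → fromℤ (s ◃ n) ≈ signed s (n ×′ 1#)
    fromℤ-◃ Sign.+ zero    = refl
    fromℤ-◃ Sign.- zero    = sym -0#≈0#
    fromℤ-◃ Sign.+ (suc n) = refl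
    fromℤ-◃ Sign.- (suc n) = refl

    fromℤ-sign : ∀ i → fromℤ i ≈ signed (sign i) (∣ i ∣ ×′ 1#)
    fromℤ-sign (+ n)    = refl
    fromℤ-sign -[1+ n ] = refl

    fromℤ-⊖ : ∀ m n → fromℤ (m ⊖ n) ≈ m ×′ 1# - n ×′ 1#
    fromℤ-⊖ m       zero    = sym (trans (+-congˡ -0#≈0#) (+-identityʳ _))
    fromℤ-⊖ zero    (suc n) = sym (+-identityˡ _)
    fromℤ-⊖ (suc m) (suc n) = begin
      fromℤ (suc m ⊖ suc n)       ≡⟨ ≡.cong fromℤ (ℤ.[1+m]⊖[1+n]≡m⊖n m n) ⟩
      fromℤ (m ⊖ n)               ≈⟨ fromℤ-⊖ m n ⟩
      M - N                       ≈⟨ +-identityˡ _ ⟨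
      0# + (M - N)                ≈⟨ +-cong (-‿inverseʳ 1#) (+-comm (- N) M) ⟨
      (1# - 1#) + (- N + M)       ≈⟨ +-assoc 1# (- 1#) (- N + M) ⟩
      1# + (- 1# + (- N + M))     ≈⟨ +-congˡ (+-assoc (- 1#) (- N) M) ⟨
      1# + ((- 1# + - N) + M)     ≈⟨ +-congˡ (+-comm _ M) ⟩
      1# + (M + (- 1# + - N))     ≈⟨ +-assoc 1# M _ ⟨
      (1# + M) + (- 1# + - N)     ≈⟨ +-congˡ (-‿+-comm 1# N) ⟩
      (1# + M) - (1# + N)         ≈⟨ +-cong (1+× m 1#) (-‿cong (1+× n 1#)) ⟨
      suc m ×′ 1# - suc n ×′ 1#   ∎
      where M = m ×′ 1#; N = n ×′ 1#

    fromℤ-+ : ∀ i j → fromℤ (i ℤ.+ j) ≈ fromℤ i + fromℤ j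
    fromℤ-+ (+ m)    (+ n)    = ×-homo-+ 1# m n
    fromℤ-+ (+ m)    -[1+ n ] = fromℤ-⊖ m (suc n)
    fromℤ-+ -[1+ m ] (+ n)    = trans (fromℤ-⊖ n (suc m)) (+-comm _ _)
    fromℤ-+ -[1+ m ] -[1+ n ] = begin
      - (suc (suc (m ℕ.+ n)) ×′ 1#)       ≈⟨ -‿cong (×-cong (≡.cong suc (ℕ.+-suc m n)) refl) ⟨
      - ((suc m ℕ.+ suc n) ×′ 1#)         ≈⟨ -‿cong (×-homo-+ 1# (suc m) (suc n)) ⟩
      - (suc m ×′ 1# + suc n ×′ 1#)       ≈⟨ -‿+-comm _ _ ⟨
      - (suc m ×′ 1#) + - (suc n ×′ 1#)   ∎

    fromℤ-* : ∀ i j → fromℤ (i ℤ.* j) ≈ fromℤ i * fromℤ j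
    fromℤ-* i j = begin
      fromℤ (s ◃ ∣ i ∣ ℕ.* ∣ j ∣)
        ≈⟨ fromℤ-◃ s (∣ i ∣ ℕ.* ∣ j ∣) ⟩
      signed s ((∣ i ∣ ℕ.* ∣ j ∣) ×′ 1#)
        ≈⟨ signed-cong s (×1-homo-* ∣ i ∣ ∣ j ∣) ⟩
      signed s ((∣ i ∣ ×′ 1#) * (∣ j ∣ ×′ 1#))
        ≈⟨ signed-* (sign i) (sign j) _ _ ⟩
      signed (sign i) (∣ i ∣ ×′ 1#) * signed (sign j) (∣ j ∣ ×′ 1#)
        ≈⟨ *-cong (fromℤ-sign i) (fromℤ-sign j) ⟨
      fromℤ i * fromℤ j
        ∎
      where s = sign i Sign.* sign j

    fromℤ-neg : ∀ i → fromℤ (ℤ.- i) ≈ - fromℤ i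
    fromℤ-neg (+ zero)  = sym -0#≈0#
    fromℤ-neg (+ suc n) = refl
    fromℤ-neg -[1+ n ]  = sym (-‿involutive _)

    homomorphism : ℤ.+-*-rawRing -Raw-AlmostCommutative⟶ fromCommutativeRing CR
    homomorphism = record
      { ⟦_⟧ = fromℤ ; +-homo = fromℤ-+ ; *-homo = fromℤ-* ; -‿homo = fromℤ-neg ; 0-homo = refl ; 1-homo = refl }

    fromℤ-≟ : ∀ i j → Maybe (fromℤ i ≈ fromℤ j)
    fromℤ-≟ i j with i ℤ.≟ j
    ... | yes ≡.refl = just refl
    ... | no _       = nothing

  open import Algebra.Solver.Ring ℤ.+-*-rawRing (fromCommutativeRing CR) homomorphism fromℤ-≟ public

progression : ℕ → ℕ → ℕ → List ℕ
progression r d = applyUpTo (λ t → r ℕ.+ t ℕ.* d)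

progression-step : ∀ r d t → r ℕ.+ suc t ℕ.* d ≡ d ℕ.+ (r ℕ.+ t ℕ.* d)
progression-step = solve-∀

module PowerSums {c ℓ} (CR : CommutativeRing c ℓ) where

  import Data.Nat.Properties as ℕ
  open import Data.Fin.Base using (zero; suc)
  open import Data.List.Base using ([]; _∷_; _++_; concat; foldr)
  open import Data.List.Properties using (map-applyUpTo; concat-map; map-tabulate)
  open import Data.List.Relation.Binary.Permutation.Propositional using (↭⇒↭ₛ′)
  open import Data.List.Relation.Binary.Permutation.Propositional.Properties using (map⁺)
  import Data.List.Relation.Binary.Permutation.Setoid.Properties as Permutationₛ
  open import Data.List.Relation.Binary.BagAndSetEquality using (∼bag⇒↭)
  open import Data.List.Membership.Propositional.Properties.WithK using (unique∧set⇒bag)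
  import Data.Integer.Base as ℤ
  open CommutativeRing CR hiding (zero)
  open import Algebra.Properties.Semiring.Sum semiring using (sum; sum-cong-≋; ∑-distrib-+; *-distribˡ-sum)
  open import Algebra.Properties.Semiring.Mult semiring
    using (×-assoc-*; ×-congˡ; ×-congʳ; ×-homo-+) renaming (_×_ to _·_)
  open import Algebra.Properties.Semiring.Exp semiring using (_^_; ^-congʳ; ^-homo-*)
  open import Relation.Binary.Reasoning.Setoid setoid
  open IntegerCoefficients CR

  -- Definitionally the Field.∑ of Defs, so these lemmas apply to it directly.
  ∑ : List Carrier → Carrier
  ∑ = foldr _+_ 0#

  ∑-++ : ∀ xs ys → ∑ (xs ++ ys) ≈ ∑ xs + ∑ ys
  ∑-++ []       ys = sym (+-identityˡ (∑ ys))
  ∑-++ (x ∷ xs) ys = trans (+-congˡ (∑-++ xs ys)) (sym (+-assoc x (∑ xs) (∑ ys)))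

  ∑-map-unique : ∀ {a} {A : Set a} (f : A → Carrier) {xs ys} → Unique xs → Unique ys →
    (∀ x → (x ∈ xs) ⇔ (x ∈ ys)) → ∑ (map f xs) ≈ ∑ (map f ys)
  ∑-map-unique f xs! ys! xs⇔ys =
    Permutationₛ.foldr-commMonoid setoid +-isCommutativeMonoid
      (↭⇒↭ₛ′ isEquivalence (map⁺ f (∼bag⇒↭ (unique∧set⇒bag xs! ys! (λ {x} → xs⇔ys x)))))

  ∑-tabulate : ∀ {n} (f : Fin n → Carrier) → ∑ (tabulate f) ≡ sum f
  ∑-tabulate {zero}  f = ≡.refl
  ∑-tabulate {suc n} f = ≡.cong (f zero +_) (∑-tabulate (λ i → f (suc i)))

  ∑-concat-tabulate : ∀ {n} (f : Fin n → List Carrier) → ∑ (concat (tabulate f)) ≈ sum (λ i → ∑ (f i))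
  ∑-concat-tabulate {zero}  f = refl
  ∑-concat-tabulate {suc n} f = trans (∑-++ (f zero) _) (+-congˡ (∑-concat-tabulate (λ i → f (suc i))))

  ∑-map-concat-tabulate : ∀ {a} {A : Set a} (f : A → Carrier) {n} (xss : Fin n → List A) →
    ∑ (map f (concat (tabulate xss))) ≈ sum (λ i → ∑ (map f (xss i)))
  ∑-map-concat-tabulate f xss = begin
    ∑ (map f (concat (tabulate xss)))              ≡⟨ ≡.cong ∑ (concat-map (tabulate xss)) ⟨
    ∑ (concat (map (map f) (tabulate xss)))        ≡⟨ ≡.cong (λ yss → ∑ (concat yss)) (map-tabulate xss (map f)) ⟩
    ∑ (concat (tabulate (λ i → map f (xss i))))    ≈⟨ ∑-concat-tabulate (λ i → map f (xss i)) ⟩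
    sum (λ i → ∑ (map f (xss i)))                  ∎

  ∑-applyUpTo : ∀ (f : ℕ → Carrier) n → ∑ (applyUpTo f n) ≡ sum {n} (λ i → f (toℕ i))
  ∑-applyUpTo f zero    = ≡.refl
  ∑-applyUpTo f (suc n) = ≡.cong (f 0 +_) (∑-applyUpTo (λ t → f (suc t)) n)

  ∑-applyUpTo-cong : ∀ {f g : ℕ → Carrier} → (∀ t → f t ≈ g t) → ∀ n →
    ∑ (applyUpTo f n) ≈ ∑ (applyUpTo g n)
  ∑-applyUpTo-cong f≈g zero    = refl
  ∑-applyUpTo-cong f≈g (suc n) = +-cong (f≈g 0) (∑-applyUpTo-cong (λ t → f≈g (suc t)) n)

  sum-*+ : ∀ {n} u (f g : Fin n → Carrier) → sum (λ i → u * f i + g i) ≈ u * sum f + sum g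
  sum-*+ u f g = trans (∑-distrib-+ (λ i → u * f i) g) (+-congʳ (sym (*-distribˡ-sum u f)))

  sum-*+* : ∀ {n} u v (f g h : Fin n → Carrier) →
    sum (λ i → u * f i + g i + v * h i) ≈ u * sum f + sum g + v * sum h
  sum-*+* u v f g h =
    trans (∑-distrib-+ (λ i → u * f i + g i) (λ i → v * h i)) (+-cong (sum-*+ u f g) (sym (*-distribˡ-sum v h)))

  ·-as-* : ∀ n y → n · y ≈ (n · 1#) * y
  ·-as-* n y = sym (trans (×-assoc-* n 1# y) (×-congʳ n (*-identityˡ y)))

  geometric-telescope : ∀ q (h : ℕ → Carrier) → (∀ t → h (suc t) ≈ q * h t) →
    ∀ T → (q - 1#) * ∑ (applyUpTo h T) + h 0 ≈ h T
  geometric-telescope q h h-step zero    = trans (+-congʳ (zeroʳ _)) (+-identityˡ (h 0))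
  geometric-telescope q h h-step (suc T) = begin
    (q - 1#) * (h 0 + H) + h 0   ≈⟨ solve 3 (λ q h₀ H → (q :- con (ℤ.+ 1)) :* (h₀ :+ H) :+ h₀
                                                     := (q :- con (ℤ.+ 1)) :* H :+ q :* h₀) refl q (h 0) H ⟩
    (q - 1#) * H + q * h 0       ≈⟨ +-congˡ (h-step 0) ⟨
    (q - 1#) * H + h 1           ≈⟨ geometric-telescope q (λ t → h (suc t)) (λ t → h-step (suc t)) T ⟩
    h (suc T)                    ∎
    where H = ∑ (applyUpTo (λ t → h (suc t)) T)

  weighted-telescope : ∀ q δ (w h : ℕ → Carrier) →
    (∀ t → w (suc t) ≈ δ + w t) → (∀ t → h (suc t) ≈ q * h t) →
    ∀ T → (q - 1#) * ∑ (applyUpTo (λ t → w t * h t) T) + w 0 * h 0 + δ * (q * ∑ (applyUpTo h T)) ≈ w T * h T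
  weighted-telescope q δ w h w-step h-step zero =
    solve 4 (λ q δ w₀ h₀ → (q :- con (ℤ.+ 1)) :* con (ℤ.+ 0) :+ w₀ :* h₀ :+ δ :* (q :* con (ℤ.+ 0))
                         := w₀ :* h₀)
            refl q δ (w 0) (h 0)
  weighted-telescope q δ w h w-step h-step (suc T) = begin
    (q - 1#) * (w 0 * h 0 + S) + w 0 * h 0 + δ * (q * (h 0 + H))
      ≈⟨ solve 6 (λ q δ w₀ h₀ S H →
                    (q :- con (ℤ.+ 1)) :* (w₀ :* h₀ :+ S) :+ w₀ :* h₀ :+ δ :* (q :* (h₀ :+ H))
                 := (q :- con (ℤ.+ 1)) :* S :+ (δ :+ w₀) :* (q :* h₀) :+ δ :* (q :* H))
               refl q δ (w 0) (h 0) S H ⟩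
    (q - 1#) * S + (δ + w 0) * (q * h 0) + δ * (q * H)
      ≈⟨ +-congʳ (+-congˡ (*-cong (w-step 0) (h-step 0))) ⟨
    (q - 1#) * S + w 1 * h 1 + δ * (q * H)
      ≈⟨ weighted-telescope q δ (λ t → w (suc t)) (λ t → h (suc t))
                            (λ t → w-step (suc t)) (λ t → h-step (suc t)) T ⟩
    w (suc T) * h (suc T)
      ∎
    where
    S = ∑ (applyUpTo (λ t → w (suc t) * h (suc t)) T)
    H = ∑ (applyUpTo (λ t → h (suc t)) T)

  ·-weighted-telescope : ∀ q d (e : ℕ → ℕ) (h : ℕ → Carrier) →
    (∀ t → e (suc t) ≡ d ℕ.+ e t) → (∀ t → h (suc t) ≈ q * h t) →
    ∀ T → (q - 1#) * ∑ (applyUpTo (λ t → e t · h t) T) + e 0 · h 0 + (d · q) * ∑ (applyUpTo h T) ≈ e T · h T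
  ·-weighted-telescope q d e h e-step h-step T = begin
    (q - 1#) * ∑ (applyUpTo (λ t → e t · h t) T) + e 0 · h 0 + (d · q) * H
      ≈⟨ +-cong (+-cong (*-congˡ (∑-applyUpTo-cong (λ t → ·-as-* (e t) (h t)) T)) (·-as-* (e 0) (h 0)))
                (trans (*-congʳ (·-as-* d q)) (*-assoc _ q H)) ⟩
    (q - 1#) * ∑ (applyUpTo (λ t → w t * h t) T) + w 0 * h 0 + (d · 1#) * (q * H)
      ≈⟨ weighted-telescope q (d · 1#) w h w-step h-step T ⟩
    w T * h T
      ≈⟨ ·-as-* (e T) (h T) ⟨
    e T · h T
      ∎
    where
    H = ∑ (applyUpTo h T)
    w : ℕ → Carrier
    w t = e t · 1#
    w-step : ∀ t → w (suc t) ≈ d · 1# + w t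
    w-step t = trans (×-congˡ (e-step t)) (×-homo-+ 1# d (e t))

  ∑-^-progression : ∀ x r d T →
    (x ^ d - 1#) * ∑ (map (x ^_) (progression r d T)) + x ^ r ≈ x ^ (r ℕ.+ T ℕ.* d)
  ∑-^-progression x r d T = begin
    (x ^ d - 1#) * ∑ (map (x ^_) (progression r d T)) + x ^ r
      ≡⟨ ≡.cong₂ (λ s n → (x ^ d - 1#) * ∑ s + x ^ n) (map-applyUpTo _ (x ^_) T) (≡.sym (ℕ.+-identityʳ r)) ⟩
    (x ^ d - 1#) * ∑ (applyUpTo h T) + h 0
      ≈⟨ geometric-telescope (x ^ d) h h-step T ⟩
    h T
      ∎
    where
    h : ℕ → Carrier
    h t = x ^ (r ℕ.+ t ℕ.* d)
    h-step : ∀ t → h (suc t) ≈ x ^ d * h t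
    h-step t = trans (^-congʳ x (progression-step r d t)) (^-homo-* x d _)

  ∑-·^-progression : ∀ x r d T →
    (x ^ d - 1#) * ∑ (map (λ n → n · x ^ n) (progression r d T)) + r · x ^ r
      + (d · x ^ d) * ∑ (map (x ^_) (progression r d T))
    ≈ (r ℕ.+ T ℕ.* d) · x ^ (r ℕ.+ T ℕ.* d)
  ∑-·^-progression x r d T = begin
    (x ^ d - 1#) * ∑ (map (λ n → n · x ^ n) (progression r d T)) + r · x ^ r
      + (d · x ^ d) * ∑ (map (x ^_) (progression r d T))
      ≡⟨ ≡.cong₂ (λ s s′ → (x ^ d - 1#) * ∑ s + r · x ^ r + (d · x ^ d) * ∑ s′)
                 (map-applyUpTo e (λ n → n · x ^ n) T) (map-applyUpTo e (x ^_) T) ⟩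
    (x ^ d - 1#) * S + r · x ^ r + (d · x ^ d) * H
      ≡⟨ ≡.cong (λ n → (x ^ d - 1#) * S + n · x ^ n + (d · x ^ d) * H) (≡.sym (ℕ.+-identityʳ r)) ⟩
    (x ^ d - 1#) * S + e 0 · h 0 + (d · x ^ d) * H
      ≈⟨ ·-weighted-telescope (x ^ d) d e h (progression-step r d) h-step T ⟩
    e T · h T
      ∎
    where
    e : ℕ → ℕ
    e t = r ℕ.+ t ℕ.* d
    h : ℕ → Carrier
    h t = x ^ e t
    h-step : ∀ t → h (suc t) ≈ x ^ d * h t
    h-step t = trans (^-congʳ x (progression-step r d t)) (^-homo-* x d _)
    S = ∑ (applyUpTo (λ t → e t · h t) T)
    H = ∑ (applyUpTo h T)

  geometric-sum : ∀ x n → (x - 1#) * sum {n} (λ i → x ^ toℕ i) + 1# ≈ x ^ n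
  geometric-sum x n =
    ≡.subst (λ s → (x - 1#) * s + 1# ≈ x ^ n) (∑-applyUpTo (x ^_) n) (geometric-telescope x (x ^_) (λ _ → refl) n)

  arithmetico-geometric-sum : ∀ x n →
    (x - 1#) * sum {n} (λ i → toℕ i · x ^ toℕ i) + x * sum {n} (λ i → x ^ toℕ i) ≈ n · x ^ n
  arithmetico-geometric-sum x n = begin
    (x - 1#) * sum {n} (λ i → toℕ i · x ^ toℕ i) + x * sum {n} (λ i → x ^ toℕ i)
      ≈⟨ +-cong (+-identityʳ _) (*-congʳ (+-identityʳ x)) ⟨
    (x - 1#) * sum {n} (λ i → toℕ i · x ^ toℕ i) + 0# + (x + 0#) * sum {n} (λ i → x ^ toℕ i)
      ≡⟨ ≡.cong₂ (λ s s′ → (x - 1#) * s + 0# + (x + 0#) * s′)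
                 (≡.sym (∑-applyUpTo (λ t → t · x ^ t) n)) (≡.sym (∑-applyUpTo (x ^_) n)) ⟩
    (x - 1#) * ∑ (applyUpTo (λ t → t · x ^ t) n) + 0 · x ^ 0 + (1 · x) * ∑ (applyUpTo (x ^_) n)
      ≈⟨ ·-weighted-telescope x 1 (λ t → t) (x ^_) (λ _ → ≡.refl) (λ _ → refl) n ⟩
    n · x ^ n
      ∎

  module _ (x : Carrier) {a} (m T : Fin a → ℕ) (m≡i+Ta : ∀ i → m i ≡ toℕ i ℕ.+ T i ℕ.* a) where

    private
      G S : Fin a → Carrier
      G i = ∑ (map (x ^_) (progression (toℕ i) a (T i)))
      S i = ∑ (map (λ n → n · x ^ n) (progression (toℕ i) a (T i)))

    sum-^-progressions : (x ^ a - 1#) * sum G + sum {a} (λ i → x ^ toℕ i) ≈ sum {a} (λ i → x ^ m i)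
    sum-^-progressions =
      trans (sym (sum-*+ (x ^ a - 1#) G (λ i → x ^ toℕ i))) (sum-cong-≋ λ i →
      trans (∑-^-progression x (toℕ i) a (T i)) (^-congʳ x (≡.sym (m≡i+Ta i))))

    sum-·^-progressions :
      (x ^ a - 1#) * sum S + sum {a} (λ i → toℕ i · x ^ toℕ i) + (a · x ^ a) * sum G
      ≈ sum {a} (λ i → m i · x ^ m i)
    sum-·^-progressions =
      trans (sym (sum-*+* (x ^ a - 1#) (a · x ^ a) S (λ i → toℕ i · x ^ toℕ i) G)) (sum-cong-≋ λ i →
      trans (∑-·^-progression x (toℕ i) a (T i)) (reflexive (≡.cong (λ n → n · x ^ n) (≡.sym (m≡i+Ta i)))))

module FieldProperties {c ℓ} (F : Field c ℓ) where

  open Field F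
  open import Algebra.Properties.Ring ring using (x∙y⁻¹≈ε⇒x≈y)
  import Data.Integer.Base as ℤ
  open import Relation.Binary.Reasoning.Setoid setoid
  open IntegerCoefficients commutativeRing

  x-y≉0 : ∀ {x y} → ¬ x ≈ y → ¬ x - y ≈ 0#
  x-y≉0 x≉y x-y≈0 = x≉y (x∙y⁻¹≈ε⇒x≈y _ _ x-y≈0)

  ⁻¹-unique : ∀ {y w} → y * w ≈ 1# → y ⁻¹ ≈ w
  ⁻¹-unique {y} {w} yw≈1 = begin
    y ⁻¹             ≈⟨ *-identityʳ (y ⁻¹) ⟨
    y ⁻¹ * 1#        ≈⟨ *-congˡ yw≈1 ⟨
    y ⁻¹ * (y * w)   ≈⟨ solve 3 (λ y y′ w → y′ :* (y :* w) := (y :* y′) :* w) refl y (y ⁻¹) w ⟩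
    y * y ⁻¹ * w     ≈⟨ *-congʳ (⁻¹-inverseʳ y y≉0) ⟩
    1# * w           ≈⟨ *-identityˡ w ⟩
    w                ∎
    where
    y≉0 : ¬ y ≈ 0#
    y≉0 y≈0 = 0≉1 (trans (sym (trans (*-congʳ y≈0) (zeroˡ w))) yw≈1)

  ⁻¹-distrib-* : ∀ {y z} → ¬ y ≈ 0# → ¬ z ≈ 0# → (y * z) ⁻¹ ≈ y ⁻¹ * z ⁻¹
  ⁻¹-distrib-* {y} {z} y≉0 z≉0 = ⁻¹-unique (begin
    y * z * (y ⁻¹ * z ⁻¹)   ≈⟨ solve 4 (λ y z y′ z′ → y :* z :* (y′ :* z′) := y :* y′ :* (z :* z′))
                                       refl y z (y ⁻¹) (z ⁻¹) ⟩
    y * y ⁻¹ * (z * z ⁻¹)   ≈⟨ *-cong (⁻¹-inverseʳ y y≉0) (⁻¹-inverseʳ z z≉0) ⟩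
    1# * 1#                 ≈⟨ *-identityˡ 1# ⟩
    1#                      ∎)

  solve-linear : ∀ {y w z b c} → y * w ≈ 1# → y * z + b ≈ c → z ≈ w * (c - b)
  solve-linear {y} {w} {z} {b} {c} yw≈1 yz+b≈c = begin
    z                     ≈⟨ *-identityˡ z ⟨
    1# * z                ≈⟨ *-congʳ yw≈1 ⟨
    y * w * z             ≈⟨ solve 4 (λ y w z b → y :* w :* z := w :* (y :* z :+ b :- b)) refl y w z b ⟩
    w * (y * z + b - b)   ≈⟨ *-congˡ (+-congʳ yz+b≈c) ⟩
    w * (c - b)           ∎

  closed-form : ∀ {q x S G′ I L M G B} → ¬ q - 1# ≈ 0# → ¬ x - 1# ≈ 0# →
    (q - 1#) * S + I + B * G′ ≈ M → (q - 1#) * G′ + L ≈ G →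
    (x - 1#) * L + 1# ≈ q → (x - 1#) * I + x * L ≈ B →
    S ≈ 1# / (q - 1#) * M - B / ((q - 1#) * (q - 1#)) * G + x / ((x - 1#) * (x - 1#))
  closed-form {q} {x} {S} {G′} {I} {L} {M} {G} {B} q-1≉0 x-1≉0 S-eq G′-eq L-eq I-eq = begin
    S
      ≈⟨ solve-linear Qu≈1 (trans (sym (+-assoc _ I _)) S-eq) ⟩
    u * (M - (I + B * G′))
      ≈⟨ *-congˡ (+-congˡ (-‿cong (+-cong (solve-linear Xv≈1 I-eq) (*-congˡ (solve-linear Qu≈1 G′-eq))))) ⟩
    u * (M - (v * (B - x * L) + B * (u * (G - L))))
      ≈⟨ *-congˡ (+-congˡ (-‿cong (+-cong (*-congˡ (+-congˡ (-‿cong (*-congˡ L≈))))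
                                          (*-congˡ (*-congˡ (+-congˡ (-‿cong L≈))))))) ⟩
    u * (M - (v * (B - x * (v * (q - 1#))) + B * (u * (G - v * (q - 1#)))))
      ≈⟨ solve 7 (λ u v q x B M G →
           u :* (M :- (v :* (B :- x :* (v :* (q :- con (ℤ.+ 1)))) :+ B :* (u :* (G :- v :* (q :- con (ℤ.+ 1))))))
           := con (ℤ.+ 1) :* u :* M :- B :* (u :* u) :* G :+ x :* (v :* v)
              :+ ((q :- con (ℤ.+ 1)) :* u :- con (ℤ.+ 1)) :* (B :* u :* v :+ x :* v :* v))
         refl u v q x B M G ⟩
    1# * u * M - B * (u * u) * G + x * (v * v) + ((q - 1#) * u - 1#) * (B * u * v + x * v * v)
      ≈⟨ +-congˡ (trans (*-congʳ (trans (+-congʳ Qu≈1) (-‿inverseʳ 1#))) (zeroˡ _)) ⟩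
    1# * u * M - B * (u * u) * G + x * (v * v) + 0#
      ≈⟨ +-identityʳ _ ⟩
    1# * u * M - B * (u * u) * G + x * (v * v)
      ≈⟨ +-cong (+-congˡ (-‿cong (*-congʳ (*-congˡ (⁻¹-distrib-* q-1≉0 q-1≉0)))))
                (*-congˡ (⁻¹-distrib-* x-1≉0 x-1≉0)) ⟨
    1# / (q - 1#) * M - B / ((q - 1#) * (q - 1#)) * G + x / ((x - 1#) * (x - 1#))
      ∎
    where
    u = (q - 1#) ⁻¹
    v = (x - 1#) ⁻¹
    Qu≈1 : (q - 1#) * u ≈ 1#
    Qu≈1 = ⁻¹-inverseʳ (q - 1#) q-1≉0
    Xv≈1 : (x - 1#) * v ≈ 1#
    Xv≈1 = ⁻¹-inverseʳ (x - 1#) x-1≉0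
    L≈ : L ≈ v * (q - 1#)
    L≈ = solve-linear Xv≈1 L-eq

module NumericalSemigroups where

  open import Data.Nat.Base using (_+_; _*_; _∸_; NonZero)
  open import Data.Nat.Properties
    using (_≟_; _<?_; +-identityʳ; +-assoc; *-distribʳ-+; m≤m+n; m≤n+m; ≤-trans; <-≤-trans; <⇒≢; <⇒≱; ≮⇒≥;
           n≢0⇒n>0; m*n≡0⇒m≡0; m+[n∸m]≡n; +-cancelˡ-≡; +-cancelˡ-≤; *-cancelʳ-≡; *-cancelʳ-≤)
  open import Data.Nat.DivMod using (_%_; _/_; m%n<n; m≡m%n+[m/n]*n; [m+kn]%n≡m%n; m<n⇒m%n≡m)
  import Data.Fin.Base as Fin
  open import Data.Fin.Properties using (toℕ<n; toℕ-fromℕ<; toℕ-injective) renaming (<⇒≢ to <⇒≢ᶠ)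
  open import Data.Vec.Base using ([]; replicate; toList; zipWith)
  open import Data.List.Base using (concat)
  open import Data.List.Membership.Propositional.Properties
    using (∈-applyUpTo⁺; ∈-applyUpTo⁻; ∈-concat⁺; ∈-concat⁻)
  open import Data.List.Relation.Unary.All.Properties using () renaming (tabulate⁺ to All-tabulate⁺)
  open import Data.List.Relation.Unary.Any.Properties using ()
    renaming (tabulate⁺ to Any-tabulate⁺; tabulate⁻ to Any-tabulate⁻)
  open import Data.List.Relation.Unary.AllPairs.Properties using (tabulate⁺-<)
  open import Data.List.Relation.Unary.Unique.Propositional.Properties using (concat⁺; applyUpTo⁺₁)
  open import Data.List.Relation.Binary.Disjoint.Propositional using (Disjoint)
  open import Data.Nat.ListAction using () renaming (sum to sumℕ)
  open import Data.Product using (∃; _,_; proj₁; proj₂)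
  open import Data.Sum using (inj₁; inj₂)
  open import Data.Empty using (⊥-elim)
  open import Function.Bundles using (mk⇔)
  open import Relation.Nullary using (Dec; yes; no)
  open import Relation.Binary.PropositionalEquality using (refl; sym; trans; cong; subst; subst₂; module ≡-Reasoning)

  zero-combination : ∀ {k} (A : Vec ℕ k) → sumℕ (toList (zipWith _*_ (replicate k 0) A)) ≡ 0
  zero-combination []      = refl
  zero-combination (_ ∷ A) = zero-combination A

  R-* : ∀ {k a} (A : Vec ℕ k) q → 0 < q * a → R (a ∷ A) (q * a)
  R-* A q 0<qa = 0<qa , (q ∷ replicate _ 0) , trans (cong (q * _ +_) (zero-combination A)) (+-identityʳ _)

  R-+-* : ∀ {k a n} {A : Vec ℕ k} → R (a ∷ A) n → ∀ s → R (a ∷ A) (n + s * a)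
  R-+-* {a = a} {n} (0<n , (x ∷ xs) , x*a+rest≡n) s =
    <-≤-trans 0<n (m≤m+n n (s * a)) , (x + s ∷ xs) , trans (shift x s a _) (cong (_+ s * a) x*a+rest≡n)
    where
    shift : ∀ x s a r → (x + s) * a + r ≡ (x * a + r) + s * a
    shift = solve-∀

  ≡[mod]⇒≡+* : ∀ {n r a} → r < a → n ≡ r [mod a ] → ∃ λ q → n ≡ r + q * a
  ≡[mod]⇒≡+* _ (inj₂ n≡r+qa) = n≡r+qa
  ≡[mod]⇒≡+* {n} {r} _ (inj₁ (zero , n+0≡r)) = 0 , trans (sym (+-identityʳ n)) (trans n+0≡r (sym (+-identityʳ r)))
  ≡[mod]⇒≡+* {n} {r} {a} r<a (inj₁ (suc q , n+[a+qa]≡r)) =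
    ⊥-elim (<⇒≱ r<a (subst (a ≤_) n+[a+qa]≡r (≤-trans (m≤m+n a (q * a)) (m≤n+m _ n))))

  module Apéry {k} (a : ℕ) {{_ : NonZero a}} (A : Vec ℕ k) (m : Fin a → ℕ)
    (m-zero : ∀ i → toℕ i ≡ 0 → m i ≡ 0)
    (m-least : ∀ i → ¬ (toℕ i ≡ 0) →
      (0 < m i) × (m i ≡ toℕ i [mod a ]) × R (a ∷ A) (m i) ×
      (∀ n → 0 < n → n ≡ toℕ i [mod a ] → R (a ∷ A) n → m i ≤ n))
    where

    private
      m-congruent : ∀ i → ¬ (toℕ i ≡ 0) → m i ≡ toℕ i [mod a ]
      m-congruent i i≢0 = proj₁ (proj₂ (m-least i i≢0))

      m-representable : ∀ i → ¬ (toℕ i ≡ 0) → R (a ∷ A) (m i)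
      m-representable i i≢0 = proj₁ (proj₂ (proj₂ (m-least i i≢0)))

      m-minimal : ∀ i → ¬ (toℕ i ≡ 0) → ∀ n → 0 < n → n ≡ toℕ i [mod a ] → R (a ∷ A) n → m i ≤ n
      m-minimal i i≢0 = proj₂ (proj₂ (proj₂ (m-least i i≢0)))

      gapCount-spec : ∀ i → ∃ λ T → m i ≡ toℕ i + T * a
      gapCount-spec i with toℕ i ≟ 0
      ... | yes i≡0 = 0 , trans (m-zero i i≡0) (sym (trans (+-identityʳ (toℕ i)) i≡0))
      ... | no  i≢0 = ≡[mod]⇒≡+* (toℕ<n i) (m-congruent i i≢0)

    gapCount : Fin a → ℕ
    gapCount i = proj₁ (gapCount-spec i)

    m≡i+gapCount*a : ∀ i → m i ≡ toℕ i + gapCount i * a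
    m≡i+gapCount*a i = proj₂ (gapCount-spec i)

    gapCount-zero : ∀ i → toℕ i ≡ 0 → gapCount i ≡ 0
    gapCount-zero i i≡0 = m*n≡0⇒m≡0 (gapCount i) a (begin
      gapCount i * a             ≡⟨ cong (_+ gapCount i * a) i≡0 ⟨
      toℕ i + gapCount i * a     ≡⟨ m≡i+gapCount*a i ⟨
      m i                        ≡⟨ m-zero i i≡0 ⟩
      0                          ∎)
      where open ≡-Reasoning

    gaps : Fin a → List ℕ
    gaps i = progression (toℕ i) a (gapCount i)

    allGaps : List ℕ
    allGaps = concat (tabulate gaps)

    ∈gaps⇒NR : ∀ {n} i → n ∈ gaps i → NR (a ∷ A) n
    ∈gaps⇒NR {n} i n∈gaps with ∈-applyUpTo⁻ (λ t → toℕ i + t * a) n∈gaps | toℕ i ≟ 0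
    ... | t , t<T , _       | yes i≡0 = ⊥-elim (<⇒≱ t<T (subst (_≤ t) (sym (gapCount-zero i i≡0)) z≤n))
    ... | t , t<T , n≡i+ta  | no  i≢0 = 0<n , ¬R
      where
      0<n : 0 < n
      0<n = subst (0 <_) (sym n≡i+ta) (<-≤-trans (n≢0⇒n>0 i≢0) (m≤m+n _ _))
      ¬R : ¬ R (a ∷ A) n
      ¬R Rn = <⇒≱ t<T (*-cancelʳ-≤ (gapCount i) t a (+-cancelˡ-≤ (toℕ i) _ _
        (subst₂ _≤_ (m≡i+gapCount*a i) n≡i+ta (m-minimal i i≢0 n 0<n (inj₂ (t , n≡i+ta)) Rn))))

    NR⇒∈gaps : ∀ {n} → NR (a ∷ A) n → ∃ λ i → n ∈ gaps i
    NR⇒∈gaps {n} (0<n , ¬R) = i , gap (toℕ i ≟ 0)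
      where
      i = Fin.fromℕ< (m%n<n n a)
      q = n / a
      n≡i+qa : n ≡ toℕ i + q * a
      n≡i+qa = trans (m≡m%n+[m/n]*n n a) (cong (_+ q * a) (sym (toℕ-fromℕ< (m%n<n n a))))
      gap : Dec (toℕ i ≡ 0) → n ∈ gaps i
      gap (yes i≡0) = ⊥-elim (¬R (subst (R (a ∷ A)) (sym n≡qa) (R-* A q (subst (0 <_) n≡qa 0<n))))
        where
        n≡qa : n ≡ q * a
        n≡qa = trans n≡i+qa (cong (_+ q * a) i≡0)
      gap (no i≢0) with q <? gapCount i
      ... | yes q<T = subst (_∈ gaps i) (sym n≡i+qa) (∈-applyUpTo⁺ (λ t → toℕ i + t * a) q<T)
      ... | no  q≮T = ⊥-elim (¬R (subst (R (a ∷ A)) m+[q∸T]a≡n (R-+-* (m-representable i i≢0) (q ∸ T))))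
        where
        T = gapCount i
        m+[q∸T]a≡n : m i + (q ∸ T) * a ≡ n
        m+[q∸T]a≡n = begin
          m i + (q ∸ T) * a               ≡⟨ cong (_+ (q ∸ T) * a) (m≡i+gapCount*a i) ⟩
          toℕ i + T * a + (q ∸ T) * a     ≡⟨ +-assoc (toℕ i) (T * a) _ ⟩
          toℕ i + (T * a + (q ∸ T) * a)   ≡⟨ cong (toℕ i +_) (*-distribʳ-+ a T (q ∸ T)) ⟨
          toℕ i + (T + (q ∸ T)) * a       ≡⟨ cong (λ t → toℕ i + t * a) (m+[n∸m]≡n (≮⇒≥ q≮T)) ⟩
          toℕ i + q * a                   ≡⟨ n≡i+qa ⟨
          n                               ∎
          where open ≡-Reasoning

    ∈allGaps⇔NR : ∀ n → (n ∈ allGaps) ⇔ NR (a ∷ A) n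
    ∈allGaps⇔NR n = mk⇔
      (λ n∈allGaps → let i , n∈gaps = Any-tabulate⁻ (∈-concat⁻ (tabulate gaps) n∈allGaps)
                     in ∈gaps⇒NR i n∈gaps)
      (λ nr → let i , n∈gaps = NR⇒∈gaps nr in ∈-concat⁺ (Any-tabulate⁺ i n∈gaps))

    gaps-residue : ∀ {n} i → n ∈ gaps i → n % a ≡ toℕ i
    gaps-residue i n∈gaps with ∈-applyUpTo⁻ (λ t → toℕ i + t * a) n∈gaps
    ... | t , _ , refl = trans ([m+kn]%n≡m%n (toℕ i) t a) (m<n⇒m%n≡m (toℕ<n i))

    allGaps-unique : Unique allGaps
    allGaps-unique = concat⁺ (All-tabulate⁺ gaps-unique) (tabulate⁺-< disjoint)
      where
      gaps-unique : ∀ i → Unique (gaps i)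
      gaps-unique i = applyUpTo⁺₁ (λ t → toℕ i + t * a) (gapCount i)
        (λ s<t _ eq → <⇒≢ s<t (*-cancelʳ-≡ _ _ a (+-cancelˡ-≡ (toℕ i) _ _ eq)))
      disjoint : ∀ {i j} → i Fin.< j → Disjoint (gaps i) (gaps j)
      disjoint {i} {j} i<j (n∈i , n∈j) =
        <⇒≢ᶠ i<j (toℕ-injective (trans (sym (gaps-residue i n∈i)) (gaps-residue j n∈j)))

theorem3 : ∀ {c ℓ : Level} (F : Field c ℓ) → let open Field F in
    (k : ℕ) (k≥2 : 2 ≤ k) (A : Vec ℕ k) → All (0 <_) A → gcdVec A ≡ 1 →
    (m : Fin (a₁-of k≥2 A) → ℕ) →
    (∀ i → toℕ i ≡ 0 → m i ≡ 0) →
    (∀ i → ¬ (toℕ i ≡ 0) →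
      (0 < m i) × (m i ≡ toℕ i [mod a₁-of k≥2 A ]) × R A (m i) ×
      (∀ n → 0 < n → n ≡ toℕ i [mod a₁-of k≥2 A ] → R A n → m i ≤ n)) →
    (NRlist : List ℕ) → Unique NRlist → (∀ n → (n ∈ NRlist) ⇔ NR A n) →
    (λ′ : Carrier) → ¬ (λ′ ≈ 0#) → ¬ (λ′ ^ a₁-of k≥2 A ≈ 1#) →
    ∑ (map (λ n → n · (λ′ ^ n)) NRlist)
      ≈ (1# / (λ′ ^ a₁-of k≥2 A - 1#)) * ∑ (tabulate (λ i → m i · (λ′ ^ m i)))
        - (a₁-of k≥2 A · (λ′ ^ a₁-of k≥2 A)) / ((λ′ ^ a₁-of k≥2 A - 1#) * (λ′ ^ a₁-of k≥2 A - 1#))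
            * ∑ (tabulate (λ i → λ′ ^ m i))
        + λ′ / ((λ′ - 1#) * (λ′ - 1#))
-- gcd A ≡ 1 only serves to make the mᵢ exist, which is assumed here.
theorem3 F (suc (suc k)) (s≤s (s≤s z≤n)) (zero ∷ A) (() ∷ _) _ _ _ _ _ _ _ _ _ _
theorem3 F (suc (suc k)) (s≤s (s≤s z≤n)) (suc a′ ∷ A) _ _ m m-zero m-least NRlist NR-unique ∈NR⇔ x _ x^a≉1 =
  closed-form (x-y≉0 x^a≉1) (x-y≉0 x≉1)
    (trans (+-congʳ (+-congʳ (*-congˡ ∑-NR))) (trans (sum-·^-progressions x m gapCount m≡i+gapCount*a)
                                                      (reflexive (≡.sym (∑-tabulate (λ i → g (m i)))))))
    (trans (sum-^-progressions x m gapCount m≡i+gapCount*a) (reflexive (≡.sym (∑-tabulate (λ i → x ^ m i)))))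
    (geometric-sum x a)
    (arithmetico-geometric-sum x a)
  where
  open Field F hiding (∑)
  open PowerSums commutativeRing
  open FieldProperties F
  open NumericalSemigroups.Apéry (suc a′) A m m-zero m-least
  open Algebra.Properties.Semiring.Sum semiring using (sum)

  a = suc a′

  g : ℕ → Carrier
  g n = n · x ^ n

  x≉1 : ¬ x ≈ 1#
  x≉1 x≈1 = x^a≉1 (trans (^-congˡ a x≈1) (Algebra.Properties.Monoid.Mult.×-idem *-monoid (*-identityʳ 1#) a))
    where open import Algebra.Properties.Semiring.Exp semiring using (^-congˡ)

  ∑-NR : ∑ (map g NRlist) ≈ sum (λ i → ∑ (map g (gaps i)))
  ∑-NR = trans (∑-map-unique g NR-unique allGaps-unique (λ n → ⇔.trans (∈NR⇔ n) (⇔.sym (∈allGaps⇔NR n))))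
               (∑-map-concat-tabulate g gaps)
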